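{- Let $(W,S)$ be a Coxeter system and $C\subseteq B$ two Garside shadows in $(W,S)$. Then $\pi_C\circ\pi_B=\pi_C$.
   Context: $\ell$ is the length function; right weak order $u\le_R w$ iff $\ell(w)=\ell(u)+\ell(u^{ -1}w)$; bounded subsets have joins $\bigvee$; $v$ is a suffix of $w$ if $\ell(w)=\ell(wv^{ -1})+\ell(v)$. A Garside shadow is $B\subseteq W$ with $S\subseteq B$, closed under joins of bounded subsets and under taking suffixes; $\pi_B(w)=\bigvee\{g\in B\mid g\le_R w\}$. -}

module Defs where

open import Level using (Level; _⊔_) renaming (suc to lsuc)
open import Data.Nat using (ℕ; zero; suc; _+_; _≤_)
open import Data.List using (List; []; _∷_; length)
open import Data.Product using (Σ; ∃; _×_; _,_; proj₁)
open import Relation.Nullary using (¬_)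
open import Relation.Binary.PropositionalEquality using (_≡_)
open import Relation.Unary using (Pred)
open import Algebra.Bundles using (Group)
open import Algebra.Morphism.Structures using (module GroupMorphisms)

pow : ∀ {c ℓ} (G : Group c ℓ) → Group.Carrier G → ℕ → Group.Carrier G
pow G x zero    = Group.ε G
pow G x (suc k) = Group._∙_ G x (pow G x k)

module _ {c ℓ : Level} (W : Group c ℓ) where
  open Group W

  Gen : (S : Pred Carrier ℓ) → Set (c ⊔ ℓ)
  Gen S = Σ Carrier S

  prod : {S : Pred Carrier ℓ} → List (Gen S) → Carrier
  prod []             = ε
  prod ((s , _) ∷ ws) = s ∙ prod ws

  -- (W,S) is a Coxeter system (Bourbaki): every s ∈ S has order 2, S generates W,
  -- and W has the presentation ⟨ S | (st)^{m(s,t)} = 1 ⟩ where m(s,t) is the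
  -- order of st in W; the presentation is expressed by the universal property
  -- (existence of the extension; uniqueness follows from generation).
  record IsCoxeterSystem (S : Pred Carrier ℓ) : Set (lsuc (c ⊔ ℓ)) where
    field
      gen-nontrivial : ∀ s → S s → ¬ (s ≈ ε)
      gen-involution : ∀ s → S s → (s ∙ s) ≈ ε
      generates      : ∀ w → Σ (List (Gen S)) λ ws → prod ws ≈ w
      universal      :
        (G : Group (c ⊔ ℓ) (c ⊔ ℓ)) (f : Gen S → Group.Carrier G) →
        (∀ s t → proj₁ s ≈ proj₁ t → Group._≈_ G (f s) (f t)) →
        (∀ s t k → pow W (proj₁ s ∙ proj₁ t) k ≈ ε →
           Group._≈_ G (pow G (Group._∙_ G (f s) (f t)) k) (Group.ε G)) →
        Σ (Carrier → Group.Carrier G) λ φ →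
          GroupMorphisms.IsGroupHomomorphism (Group.rawGroup W) (Group.rawGroup G) φ ×
          (∀ s → Group._≈_ G (φ (proj₁ s)) (f s))

  record IsLengthFunction (S : Pred Carrier ℓ) (len : Carrier → ℕ) : Set (c ⊔ ℓ) where
    field
      attained : ∀ w → Σ (List (Gen S)) λ ws → (prod ws ≈ w) × (length ws ≡ len w)
      minimal  : ∀ w (ws : List (Gen S)) → prod ws ≈ w → len w ≤ length ws

  module _ (len : Carrier → ℕ) where

    _≤R_ : Carrier → Carrier → Set
    u ≤R w = len w ≡ len u + len (u ⁻¹ ∙ w)

    IsSuffix : Carrier → Carrier → Set
    IsSuffix v w = len w ≡ len (w ∙ v ⁻¹) + len v

    UpperBound : ∀ {ℓ'} → Pred Carrier ℓ' → Carrier → Set (c ⊔ ℓ')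
    UpperBound X u = ∀ x → X x → x ≤R u

    Bounded : ∀ {ℓ'} → Pred Carrier ℓ' → Set (c ⊔ ℓ')
    Bounded X = ∃ λ u → UpperBound X u

    IsJoin : ∀ {ℓ'} → Pred Carrier ℓ' → Carrier → Set (c ⊔ ℓ')
    IsJoin X j = UpperBound X j × (∀ u → UpperBound X u → j ≤R u)

    record IsGarsideShadow {ℓ'} (S : Pred Carrier ℓ) (B : Pred Carrier ℓ') : Set (lsuc (c ⊔ ℓ ⊔ ℓ')) where
      field
        contains-S   : ∀ s → S s → B s
        join-closed  : (X : Pred Carrier ℓ') → (∀ x → X x → B x) → Bounded X →
                       ∀ j → IsJoin X j → B j
        suffix-closed : ∀ w v → B w → IsSuffix v w → B v

    IsProjection : ∀ {ℓ'} → Pred Carrier ℓ' → Carrier → Carrier → Set (c ⊔ ℓ')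
    IsProjection B w p = IsJoin (λ g → B g × g ≤R w) p

-- Since w is an upper bound of {g ∈ B | g ≤_R w}, the projection p = π_B(w) satisfies p ≤_R w.
-- Hence, for C ⊆ B, an element g ∈ C lies below p iff it lies below w: one direction is
-- transitivity of ≤_R (subadditivity of ℓ), the other holds because p is an upper bound of
-- the elements of B below w. So π_C(p) and π_C(w) are joins of the same set.
module Submission where

open import Defs
open import Level using (Level)
open import Data.Nat using (ℕ; _+_; _≤_)
open import Data.Nat.Properties using (≤-antisym; ≤-reflexive; +-monoʳ-≤; +-assoc; module ≤-Reasoning)
open import Data.List using (List; []; _∷_; length; _++_)
open import Data.List.Properties using (length-++)
open import Data.Product using (_×_; _,_; proj₁; proj₂)
open import Relation.Binary.PropositionalEquality using (cong; cong₂)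
open import Relation.Unary using (Pred; _⊆_; _≐_)
open import Algebra.Bundles using (Group)
import Algebra.Properties.Group as GroupProperties

module LengthFunction {c ℓ : Level} (W : Group c ℓ) (S : Pred (Group.Carrier W) ℓ)
                      {len : Group.Carrier W → ℕ} (L : IsLengthFunction W S len) where
  open Group W
  open GroupProperties W using (\\-leftDividesˡ)
  open IsLengthFunction L

  prod-++ : (xs ys : List (Gen W S)) → prod W (xs ++ ys) ≈ prod W xs ∙ prod W ys
  prod-++ []             ys = sym (identityˡ _)
  prod-++ ((s , _) ∷ xs) ys = trans (∙-congˡ (prod-++ xs ys)) (sym (assoc _ _ _))

  -- Stated up to ≈ because len is not assumed to respect ≈.
  len-subadditive : ∀ {x y z} → z ≈ x ∙ y → len z ≤ len x + len y
  len-subadditive {x} {y} {z} z≈xy with attained x | attained y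
  ... | xs , xs≈x , ∣xs∣ | ys , ys≈y , ∣ys∣ = begin
    len z                  ≤⟨ minimal z (xs ++ ys) xs++ys≈z ⟩
    length (xs ++ ys)      ≡⟨ length-++ xs ⟩
    length xs + length ys  ≡⟨ cong₂ _+_ ∣xs∣ ∣ys∣ ⟩
    len x + len y          ∎
    where
    open ≤-Reasoning
    xs++ys≈z : prod W (xs ++ ys) ≈ z
    xs++ys≈z = trans (prod-++ xs ys) (trans (∙-cong xs≈x ys≈y) (sym z≈xy))

  ≤R-trans : ∀ {g p w} → _≤R_ W len g p → _≤R_ W len p w → _≤R_ W len g w
  ≤R-trans {g} {p} {w} g≤p p≤w = ≤-antisym
    (len-subadditive (sym (\\-leftDividesˡ g w)))
    (begin
      len g + len (g ⁻¹ ∙ w)                        ≤⟨ +-monoʳ-≤ (len g) (len-subadditive g⁻¹w-split) ⟩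
      len g + (len (g ⁻¹ ∙ p) + len (p ⁻¹ ∙ w))     ≡⟨ +-assoc (len g) _ _ ⟨
      (len g + len (g ⁻¹ ∙ p)) + len (p ⁻¹ ∙ w)     ≡⟨ cong (_+ len (p ⁻¹ ∙ w)) g≤p ⟨
      len p + len (p ⁻¹ ∙ w)                        ≡⟨ p≤w ⟨
      len w                                         ∎)
    where
    open ≤-Reasoning
    g⁻¹w-split : g ⁻¹ ∙ w ≈ (g ⁻¹ ∙ p) ∙ (p ⁻¹ ∙ w)
    g⁻¹w-split = sym (trans (assoc _ _ _) (∙-congˡ (\\-leftDividesˡ p w)))

module _ {c ℓ : Level} (W : Group c ℓ) (len : Group.Carrier W → ℕ) where

  IsJoin-cong : ∀ {ℓ₁ ℓ₂} {X : Pred (Group.Carrier W) ℓ₁} {Y : Pred (Group.Carrier W) ℓ₂} {j} →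
                X ≐ Y → IsJoin W len X j → IsJoin W len Y j
  IsJoin-cong (X⊆Y , Y⊆X) (upper , least) =
    (λ x Yx → upper x (Y⊆X Yx)) , (λ u u-bounds-Y → least u (λ x Xx → u-bounds-Y x (X⊆Y Xx)))

  projection-≤R : ∀ {ℓ'} {B : Pred (Group.Carrier W) ℓ'} {w p} →
                  IsProjection W len B w p → _≤R_ W len p w
  projection-≤R {w = w} (_ , least) = least w (λ _ → proj₂)

proposition3p4 : ∀ {c ℓ ℓ' : Level} (W : Group c ℓ) (S : Pred (Group.Carrier W) ℓ) →
                 IsCoxeterSystem W S →
                 (len : Group.Carrier W → ℕ) → IsLengthFunction W S len →
                 (B C : Pred (Group.Carrier W) ℓ') →
                 IsGarsideShadow W len S B → IsGarsideShadow W len S C → C ⊆ B →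
                 ∀ w p q → IsProjection W len B w p → IsProjection W len C p q →
                 IsProjection W len C w q
proposition3p4 W S _ len L B C _ _ C⊆B w p q πB[w]≡p πC[p]≡q =
  IsJoin-cong W len same-elements-below πC[p]≡q
  where
  open LengthFunction W S L using (≤R-trans)
  same-elements-below : (λ g → C g × _≤R_ W len g p) ≐ (λ g → C g × _≤R_ W len g w)
  same-elements-below =
    (λ (g∈C , g≤p) → g∈C , ≤R-trans g≤p (projection-≤R W len πB[w]≡p)) ,
    (λ {g} (g∈C , g≤w) → g∈C , proj₁ πB[w]≡p g (C⊆B g∈C , g≤w))
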